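{- Let $\{a_n\}_{n\ge0}$ be a sequence in $\mathfrak{G}$ with $|a_n|>1$ for all $n\ge1$, satisfying Condition (H), and let $\{p_n\},\{q_n\}$ be its $\mathcal{Q}$-pair. Then $|q_n|>|q_{n-1}|$ for all $n\ge1$.
   Context: $\mathfrak{G}$ is the ring of Gaussian integers. The $\mathcal{Q}$-pair: $p_{ -1}=1$, $p_0=a_0$, $p_{n+1}=a_{n+1}p_n+p_{n-1}$, $q_{ -1}=0$, $q_0=1$, $q_{n+1}=a_{n+1}q_n+q_{n-1}$. Let $\sigma_y:\mathbb{C}\to\mathbb{C}$, $\sigma_y(w)=-\bar w$, and $\sigma_y^k$ its $k$-fold iterate. A sequence $\{a_n\}$ in $\mathfrak{G}$ with $|a_n|>1$ for $n\ge1$ satisfies Condition (H) if for all $i,j$ with $1\le i<j$ such that $|a_j|=\sqrt2$ and $a_k=2\sigma_y^{j-k}(a_j)$ for all $k\in\{i+1,\dots,j-1\}$ (vacuous if $i=j-1$), either $a_i=2\sigma_y^{j-i}(a_j)$ or $|a_i-\sigma_y^{j-i}(a_j)|\ge2$. -}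

module Defs where

open import Data.Nat using (ℕ; zero; suc)
open import Data.Integer using (ℤ; +_; _+_; _*_; -_; _-_)
open import Data.Product using (_×_; _,_; proj₁; proj₂)
open import Relation.Binary.PropositionalEquality using (_≡_)

record 𝔊 : Set where
  constructor _+i_
  field
    re : ℤ
    im : ℤ
open 𝔊 public

infixl 6 _+ᴳ_ _-ᴳ_
infixl 7 _*ᴳ_

_+ᴳ_ : 𝔊 → 𝔊 → 𝔊
(a +i b) +ᴳ (c +i d) = (a + c) +i (b + d)

_-ᴳ_ : 𝔊 → 𝔊 → 𝔊
(a +i b) -ᴳ (c +i d) = (a - c) +i (b - d)

_*ᴳ_ : 𝔊 → 𝔊 → 𝔊
(a +i b) *ᴳ (c +i d) = (a * c - b * d) +i (a * d + b * c)

0ᴳ 1ᴳ 2ᴳ : 𝔊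
0ᴳ = (+ 0) +i (+ 0)
1ᴳ = (+ 1) +i (+ 0)
2ᴳ = (+ 2) +i (+ 0)

-- squared modulus |z|^2 = x^2 + y^2 (an integer); we compare |.| via |.|^2
norm : 𝔊 → ℤ
norm (a +i b) = a * a + b * b

σy : 𝔊 → 𝔊
σy (a +i b) = (- a) +i b

σy^ : ℕ → 𝔊 → 𝔊
σy^ zero    w = w
σy^ (suc k) w = σy (σy^ k w)

-- The 𝒬-pair, indexed with a shift: pq a (suc n) = (p_n , q_n), pq a 0 = (p_{-1}, q_{-1}) = (1 , 0)
pq : (ℕ → 𝔊) → ℕ → 𝔊 × 𝔊
pq a zero = 1ᴳ , 0ᴳ
pq a (suc zero) = a 0 , 1ᴳ
pq a (suc (suc n)) =
  (a (suc n) *ᴳ proj₁ (pq a (suc n)) +ᴳ proj₁ (pq a n)) ,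
  (a (suc n) *ᴳ proj₂ (pq a (suc n)) +ᴳ proj₂ (pq a n))

p q : (ℕ → 𝔊) → ℕ → 𝔊
p a n = proj₁ (pq a (suc n))
q a n = proj₂ (pq a (suc n))

module Submission where

-- Write Q_m = q_{m-1}, so Q_0 = 0, Q_1 = 1 and Q_{m+2} = Q_m + a_{m+1} Q_{m+1}.
-- A multiplier b "stalls" at level m when |Q_m + b Q_{m+1}| ≤ |Q_{m+1}|; the
-- theorem says a_{m+1} never stalls at level m.  By strong induction on m we may
-- assume |Q_k| < |Q_{k+1}| for all k < m.  If |a_{m+1}| ≥ 2 a stall contradicts
-- this by the parallelogram law (large-coefficient).  Otherwise |a_{m+1}|² = 2,
-- and the identity |x + b y|² - |y + b̄ x|² = (1 - |b|²)(|x|² - |y|²) turns a stall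
-- of a norm-2 multiplier b at level k+1 into a stall of a_{k+1} - σ_y(b) at
-- level k (conjugate-step).  Condition (H) either rules that out by the first
-- case, or gives a_{k+1} = 2σ_y(b), i.e. a stall of σ_y(b) at level k; descending
-- to level 0 leaves |b| ≤ 1 with |b|² = 2, which is absurd (no-stall).

open import Defs
open import Data.Nat using (ℕ; suc; _<_; _≤_; _∸_)
open import Data.Integer using (+_) renaming (_<_ to _<ℤ_; _≤_ to _≤ℤ_)
open import Data.Sum using (_⊎_)
open import Relation.Binary.PropositionalEquality using (_≡_)

open import Data.Nat using (zero; z≤n; s≤s)
import Data.Nat as ℕ
import Data.Nat.Properties as ℕP
open import Data.Nat.Induction using (<-rec)
open import Data.Integer using (-[1+_]; _+_; _*_; -_; _-_; +≤+; +<+; NonNegative; nonNegative)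
import Data.Integer.Properties as ℤP
open import Data.Integer.Tactic.RingSolver using (solve-∀)
open import Data.Sum using (inj₁; inj₂)
open import Data.Product using (proj₂)
open import Data.Empty using (⊥-elim)
open import Function using (_∘_)
open import Relation.Nullary using (¬_; yes; no)
open import Relation.Binary.PropositionalEquality
  using (_≢_; refl; sym; trans; cong; cong₂; subst; subst₂)

+ᴳ-comm : ∀ u v → u +ᴳ v ≡ v +ᴳ u
+ᴳ-comm (u₁ +i u₂) (v₁ +i v₂) = cong₂ _+i_ (ℤP.+-comm u₁ v₁) (ℤP.+-comm u₂ v₂)

norm-*ᴳ : ∀ c x → norm (c *ᴳ x) ≡ norm c * norm x
norm-*ᴳ (c₁ +i c₂) (x₁ +i x₂) = two-squares c₁ c₂ x₁ x₂
  where
  two-squares : ∀ a b c d →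
    (a * c - b * d) * (a * c - b * d) + (a * d + b * c) * (a * d + b * c)
      ≡ (a * a + b * b) * (c * c + d * d)
  two-squares = solve-∀

norm-σy : ∀ w → norm (σy w) ≡ norm w
norm-σy (x +i y) = reflect x y
  where
  reflect : ∀ x y → (- x) * (- x) + y * y ≡ x * x + y * y
  reflect = solve-∀

norm-σy^ : ∀ k w → norm (σy^ k w) ≡ norm w
norm-σy^ zero    w = refl
norm-σy^ (suc k) w = trans (norm-σy (σy^ k w)) (norm-σy^ k w)

-- The parallelogram law |u + w|² + |u - w|² = 2|u|² + 2|w|² for u = z + v, w = z.
parallelogram : ∀ z v →
  norm v + norm (z +ᴳ (z +ᴳ v)) ≡ (norm (z +ᴳ v) + norm z) + (norm (z +ᴳ v) + norm z)
parallelogram (z₁ +i z₂) (v₁ +i v₂) = law z₁ z₂ v₁ v₂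
  where
  law : ∀ z₁ z₂ v₁ v₂ →
    (v₁ * v₁ + v₂ * v₂)
      + ((z₁ + (z₁ + v₁)) * (z₁ + (z₁ + v₁)) + (z₂ + (z₂ + v₂)) * (z₂ + (z₂ + v₂)))
    ≡ (((z₁ + v₁) * (z₁ + v₁) + (z₂ + v₂) * (z₂ + v₂)) + (z₁ * z₁ + z₂ * z₂))
      + (((z₁ + v₁) * (z₁ + v₁) + (z₂ + v₂) * (z₂ + v₂)) + (z₁ * z₁ + z₂ * z₂))
  law = solve-∀

-- Exchanging the roles of x and y:  |x + b y|² - |y + b̄ x|² = (1 - |b|²)(|x|² - |y|²),
-- where y + b̄ x = y - σ_y(b) x.
conjugate-swap : ∀ x y b →
  norm (x +ᴳ b *ᴳ y) + (norm b * norm x + norm y)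
    ≡ norm (y -ᴳ σy b *ᴳ x) + (norm b * norm y + norm x)
conjugate-swap (x₁ +i x₂) (y₁ +i y₂) (b₁ +i b₂) = swap x₁ x₂ y₁ y₂ b₁ b₂
  where
  swap : ∀ x₁ x₂ y₁ y₂ b₁ b₂ →
    ((x₁ + (b₁ * y₁ - b₂ * y₂)) * (x₁ + (b₁ * y₁ - b₂ * y₂))
      + (x₂ + (b₁ * y₂ + b₂ * y₁)) * (x₂ + (b₁ * y₂ + b₂ * y₁)))
      + ((b₁ * b₁ + b₂ * b₂) * (x₁ * x₁ + x₂ * x₂) + (y₁ * y₁ + y₂ * y₂))
    ≡ ((y₁ - ((- b₁) * x₁ - b₂ * x₂)) * (y₁ - ((- b₁) * x₁ - b₂ * x₂))
      + (y₂ - ((- b₁) * x₂ + b₂ * x₁)) * (y₂ - ((- b₁) * x₂ + b₂ * x₁)))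
      + ((b₁ * b₁ + b₂ * b₂) * (y₁ * y₁ + y₂ * y₂) + (x₁ * x₁ + x₂ * x₂))
  swap = solve-∀

collect : ∀ a x z s → a *ᴳ x +ᴳ z -ᴳ s *ᴳ x ≡ z +ᴳ (a -ᴳ s) *ᴳ x
collect (a₁ +i a₂) (x₁ +i x₂) (z₁ +i z₂) (s₁ +i s₂) =
  cong₂ _+i_ (real a₁ a₂ x₁ x₂ z₁ s₁ s₂) (imaginary a₁ a₂ x₁ x₂ z₂ s₁ s₂)
  where
  real : ∀ a₁ a₂ x₁ x₂ z₁ s₁ s₂ →
    (a₁ * x₁ - a₂ * x₂ + z₁) - (s₁ * x₁ - s₂ * x₂)
      ≡ z₁ + ((a₁ - s₁) * x₁ - (a₂ - s₂) * x₂)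
  real = solve-∀
  imaginary : ∀ a₁ a₂ x₁ x₂ z₂ s₁ s₂ →
    (a₁ * x₂ + a₂ * x₁ + z₂) - (s₁ * x₂ + s₂ * x₁)
      ≡ z₂ + ((a₁ - s₁) * x₂ + (a₂ - s₂) * x₁)
  imaginary = solve-∀

minus-half : ∀ {u} c → u ≡ 2ᴳ *ᴳ c → u -ᴳ c ≡ c
minus-half (c₁ +i c₂) refl = cong₂ _+i_ (halve c₁ c₂) (halve c₂ c₁)
  where
  halve : ∀ c d → (+ 2 * c - + 0 * d) - c ≡ c
  halve = solve-∀

multiple-of-one : ∀ b → 0ᴳ +ᴳ b *ᴳ 1ᴳ ≡ b
multiple-of-one (b₁ +i b₂) = cong₂ _+i_ (real b₁ b₂) (imaginary b₁ b₂)
  where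
  real : ∀ b₁ b₂ → + 0 + (b₁ * + 1 - b₂ * + 0) ≡ b₁
  real = solve-∀
  imaginary : ∀ b₁ b₂ → + 0 + (b₁ * + 0 + b₂ * + 1) ≡ b₂
  imaginary = solve-∀

square-nonneg : ∀ i → + 0 ≤ℤ i * i
square-nonneg (+ n)    = subst (+ 0 ≤ℤ_) (sym (ℤP.+◃n≡+n (n ℕ.* n))) (+≤+ z≤n)
square-nonneg -[1+ n ] = +≤+ z≤n

norm-nonNegative : ∀ w → NonNegative (norm w)
norm-nonNegative (x +i y) = nonNegative (ℤP.+-mono-≤ (square-nonneg x) (square-nonneg y))

square-gap : ∀ i → (i * i ≡ + 0 ⊎ i * i ≡ + 1) ⊎ + 4 ≤ℤ i * i
square-gap (+ 0)           = inj₁ (inj₁ refl)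
square-gap (+ 1)           = inj₁ (inj₂ refl)
square-gap (+ suc (suc k)) = inj₂ (+≤+ (four≤square k))
  where
  four≤square : ∀ k → 4 ℕ.≤ suc (suc k) ℕ.* suc (suc k)
  four≤square k = ℕP.*-mono-≤ {2} {suc (suc k)} {2} (s≤s (s≤s z≤n)) (s≤s (s≤s z≤n))
square-gap -[1+ 0 ]        = inj₁ (inj₂ refl)
square-gap -[1+ suc k ]    = square-gap (+ suc (suc k))

-- A norm larger than 1 is 2 or at least 4: 3 is not a sum of two squares.
norm-gap : ∀ w → + 1 <ℤ norm w → norm w ≢ + 2 → + 4 ≤ℤ norm w
norm-gap (x +i y) 1<N N≢2 with square-gap x | square-gap y
... | inj₂ 4≤x² | _ =
  ℤP.≤-trans 4≤x² (ℤP.i≤i+j (x * x) (y * y) {{nonNegative (square-nonneg y)}})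
... | inj₁ _ | inj₂ 4≤y² =
  ℤP.≤-trans 4≤y² (ℤP.i≤j+i (y * y) (x * x) {{nonNegative (square-nonneg x)}})
... | inj₁ x²-small | inj₁ y²-small = small-sum x²-small y²-small 1<N N≢2
  where
  small-sum : ∀ {u v} → (u ≡ + 0 ⊎ u ≡ + 1) → (v ≡ + 0 ⊎ v ≡ + 1) →
              + 1 <ℤ u + v → u + v ≢ + 2 → + 4 ≤ℤ u + v
  small-sum (inj₁ refl) (inj₁ refl) (+<+ ())       _
  small-sum (inj₁ refl) (inj₂ refl) (+<+ (s≤s ())) _
  small-sum (inj₂ refl) (inj₁ refl) (+<+ (s≤s ())) _
  small-sum (inj₂ refl) (inj₂ refl) _              ≢2 = ⊥-elim (≢2 refl)

+-cancelʳ-≤ : ∀ {i j} k → i + k ≤ℤ j + k → i ≤ℤ j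
+-cancelʳ-≤ {i} {j} k i+k≤j+k = begin
  i          ≡⟨ sym (add-sub i k) ⟩
  i + k - k  ≤⟨ ℤP.+-monoˡ-≤ (- k) i+k≤j+k ⟩
  j + k - k  ≡⟨ add-sub j k ⟩
  j          ∎
  where
  open ℤP.≤-Reasoning
  add-sub : ∀ i k → i + k - k ≡ i
  add-sub = solve-∀

-- A coefficient of modulus at least 2 always makes z + c x longer than x
-- when |z| < |x|: indeed 4|x|² ≤ |cx|² ≤ 2|z + cx|² + 2|z|² by the
-- parallelogram law.
large-coefficient : ∀ c z x → + 4 ≤ℤ norm c → norm z <ℤ norm x →
                    ¬ (norm (z +ᴳ c *ᴳ x) ≤ℤ norm x)
large-coefficient c z x 4≤|c|² z<x zcx≤x = ℤP.<-irrefl refl (begin-strict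
  + 4 * X                         ≤⟨ ℤP.*-monoʳ-≤-nonNeg X {{norm-nonNegative x}} 4≤|c|² ⟩
  norm c * X                      ≡⟨ sym (norm-*ᴳ c x) ⟩
  norm (c *ᴳ x)                   ≤⟨ ℤP.i≤i+j _ _ {{norm-nonNegative (z +ᴳ (z +ᴳ c *ᴳ x))}} ⟩
  norm (c *ᴳ x) + norm (z +ᴳ (z +ᴳ c *ᴳ x))
                                  ≡⟨ parallelogram z (c *ᴳ x) ⟩
  (U + Z) + (U + Z)               <⟨ ℤP.+-mono-< U+Z<X+X U+Z<X+X ⟩
  (X + X) + (X + X)               ≡⟨ four-times X ⟩
  + 4 * X                         ∎)
  where
  open ℤP.≤-Reasoning
  X = norm x
  Z = norm z
  U = norm (z +ᴳ c *ᴳ x)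
  U+Z<X+X : U + Z <ℤ X + X
  U+Z<X+X = ℤP.+-mono-≤-< zcx≤x z<x
  four-times : ∀ X → (X + X) + (X + X) ≡ + 4 * X
  four-times = solve-∀

-- For |b|² = 2 the swap identity reads |x + b y|² - |y + b̄ x|² = |y|² - |x|²;
-- so if y = a x + z and b fails to lengthen y past x, then a - σ_y(b)
-- fails to lengthen x past z.
conjugate-step : ∀ a b x z → norm b ≡ + 2 →
  norm (x +ᴳ b *ᴳ (a *ᴳ x +ᴳ z)) ≤ℤ norm (a *ᴳ x +ᴳ z) →
  norm (z +ᴳ (a -ᴳ σy b) *ᴳ x) ≤ℤ norm x
conjugate-step a b x z |b|²≡2 L≤Y = +-cancelʳ-≤ (+ 2 * Y + X) (begin
  W + (+ 2 * Y + X)  ≡⟨ sym swapped ⟩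
  L + (+ 2 * X + Y)  ≤⟨ ℤP.+-monoˡ-≤ (+ 2 * X + Y) L≤Y ⟩
  Y + (+ 2 * X + Y)  ≡⟨ rearrange X Y ⟩
  X + (+ 2 * Y + X)  ∎)
  where
  open ℤP.≤-Reasoning
  y = a *ᴳ x +ᴳ z
  X = norm x
  Y = norm y
  L = norm (x +ᴳ b *ᴳ y)
  W = norm (z +ᴳ (a -ᴳ σy b) *ᴳ x)
  swapped : L + (+ 2 * X + Y) ≡ W + (+ 2 * Y + X)
  swapped = subst₂ (λ β w → L + (β * X + Y) ≡ norm w + (β * Y + X))
                   |b|²≡2 (collect a x z (σy b)) (conjugate-swap x y b)
  rearrange : ∀ X Y → Y + (+ 2 * X + Y) ≡ X + (+ 2 * Y + X)
  rearrange = solve-∀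

module Denominators (a : ℕ → 𝔊) where

  -- Q (suc n) = q_n and Q 0 = q_{-1} = 0; by definition
  -- Q (m + 2) = a (m + 1) Q (m + 1) + Q m.
  Q : ℕ → 𝔊
  Q m = proj₂ (pq a m)

  Grows : ℕ → Set
  Grows m = norm (Q m) <ℤ norm (Q (suc m))

  Stalls : ℕ → 𝔊 → Set
  Stalls m b = norm (Q m +ᴳ b *ᴳ Q (suc m)) ≤ℤ norm (Q (suc m))

  Chain : ℕ → ℕ → Set
  Chain m j = ∀ k → m < k → k < j → a k ≡ 2ᴳ *ᴳ σy^ (j ∸ k) (a j)

  ConditionH : Set
  ConditionH = ∀ i j → 1 ≤ i → i < j → norm (a j) ≡ + 2 → Chain i j →
    (a i ≡ 2ᴳ *ᴳ σy^ (j ∸ i) (a j)) ⊎ (+ 4 ≤ℤ norm (a i -ᴳ σy^ (j ∸ i) (a j)))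

  -- Q (n + 2) is Q n + a (n + 1) Q (n + 1), so growth at n + 1 is the absence of a stall.
  grows-unless-stalls : ∀ n → ¬ Stalls n (a (suc n)) → Grows (suc n)
  grows-unless-stalls n no-stall = ℤP.≰⇒> λ Qn+2≤Qn+1 →
    no-stall (subst (λ u → norm u ≤ℤ norm (Q (suc n)))
                    (+ᴳ-comm (a (suc n) *ᴳ Q (suc n)) (Q n)) Qn+2≤Qn+1)

  -- At level 0 a stall means |b| ≤ 1.
  no-stall-at-start : ∀ b → norm b ≡ + 2 → ¬ Stalls 0 b
  no-stall-at-start b |b|²≡2 stall =
    two≰one (subst (_≤ℤ + 1) (trans (cong norm (multiple-of-one b)) |b|²≡2) stall)
    where
    two≰one : ¬ (+ 2 ≤ℤ + 1)
    two≰one (+≤+ (s≤s ()))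

  stall-descends : ∀ {n m} w → m < n → norm w ≡ + 2 →
    Stalls (suc m) (σy^ (n ∸ suc m) w) → Stalls m (a (suc m) -ᴳ σy^ (n ∸ m) w)
  stall-descends {n} {m} w m<n |w|²≡2 stall =
    subst (λ k → Stalls m (a (suc m) -ᴳ σy^ k w)) (sym (ℕP.+-∸-assoc 1 m<n))
      (conjugate-step (a (suc m)) (σy^ (n ∸ suc m) w) (Q (suc m)) (Q m)
        (trans (norm-σy^ (n ∸ suc m) w) |w|²≡2) stall)

  chain-extend : ∀ {m j} → a (suc m) ≡ 2ᴳ *ᴳ σy^ (j ∸ suc m) (a j) →
                 Chain (suc m) j → Chain m j
  chain-extend aₘ₊₁≡ chain k m<k k<j with ℕP.m≤n⇒m<n∨m≡n m<k
  ... | inj₁ m+1<k = chain k m+1<k k<j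
  ... | inj₂ refl  = aₘ₊₁≡

  chain-empty : ∀ n → Chain n (suc n)
  chain-empty n k n<k k<n+1 = ⊥-elim (ℕP.<⇒≱ n<k (ℕP.≤-pred k<n+1))

  module _ (hH : ConditionH) where

    no-stall : ∀ n → (∀ {m} → m < n → Grows m) → norm (a (suc n)) ≡ + 2 →
               ∀ m → m ≤ n → Chain m (suc n) → ¬ Stalls m (σy^ (n ∸ m) (a (suc n)))
    no-stall n grows-below |aⱼ|²≡2 zero _ _ =
      no-stall-at-start (σy^ n (a (suc n))) (trans (norm-σy^ n (a (suc n))) |aⱼ|²≡2)
    no-stall n grows-below |aⱼ|²≡2 (suc m) m<n chain stall
      with hH (suc m) (suc n) (s≤s z≤n) (s≤s m<n) |aⱼ|²≡2 chain
    ... | inj₂ far  = large-coefficient (a (suc m) -ᴳ σy^ (n ∸ m) (a (suc n))) (Q m) (Q (suc m))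
                        far (grows-below m<n) (stall-descends (a (suc n)) m<n |aⱼ|²≡2 stall)
    ... | inj₁ near = no-stall n grows-below |aⱼ|²≡2 m (ℕP.<⇒≤ m<n)
                        (chain-extend near chain)
                        (subst (Stalls m) (minus-half _ near)
                          (stall-descends (a (suc n)) m<n |aⱼ|²≡2 stall))

    module _ (ha : ∀ n → + 1 <ℤ norm (a (suc n))) where

      -- At n + 1, a stall of a_{n+1} is excluded by the descent when |a_{n+1}|² = 2
      -- and by large-coefficient otherwise.
      grows-step : ∀ n → (∀ {m} → m < n → Grows m) → Grows n
      grows-step zero    _           = +<+ (s≤s z≤n)
      grows-step (suc n) grows-below = grows-unless-stalls n next-does-not-stall
        where
        next-does-not-stall : ¬ Stalls n (a (suc n))
        next-does-not-stall with norm (a (suc n)) ℤP.≟ + 2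
        ... | yes |a|²≡2 =
          no-stall n (λ m<n → grows-below (ℕP.m<n⇒m<1+n m<n)) |a|²≡2
                   n ℕP.≤-refl (chain-empty n)
            ∘ subst (λ k → Stalls n (σy^ k (a (suc n)))) (sym (ℕP.n∸n≡0 n))
        ... | no |a|²≢2 =
          large-coefficient (a (suc n)) (Q n) (Q (suc n))
            (norm-gap (a (suc n)) (ha n) |a|²≢2) (grows-below (ℕP.n<1+n n))

      grows : ∀ n → Grows n
      grows = <-rec Grows grows-step

proposition5p9 :
    (a : ℕ → 𝔊) →
    -- |a_n| > 1 for n ≥ 1
    (∀ n → + 1 <ℤ norm (a (suc n))) →
    -- Condition (H)
    (∀ i j → 1 ≤ i → i < j →
      norm (a j) ≡ + 2 →
      (∀ k → i < k → k < j → a k ≡ 2ᴳ *ᴳ σy^ (j ∸ k) (a j)) →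
      (a i ≡ 2ᴳ *ᴳ σy^ (j ∸ i) (a j)) ⊎ (+ 4 ≤ℤ norm (a i -ᴳ σy^ (j ∸ i) (a j)))) →
    -- |q_n| > |q_{n-1}| for n ≥ 1
    ∀ n → norm (q a n) <ℤ norm (q a (suc n))
proposition5p9 a ha hH n = Denominators.grows a hH ha (suc n)
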